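{- Let $D_1$ and $D_2$ be tournaments such that $\mathrm{inv}(D_1)=\mathrm{inv}(D_2)\ge 1$. Then $\mathrm{inv}(D_1\rightarrow D_2)>\mathrm{inv}(D_1)$.
   Context: A tournament is an oriented graph with exactly one of the edges $uv$, $vu$ for every pair of distinct vertices. For $X\subseteq V(D)$, inverting $X$ reverses every edge with both endpoints in $X$; $\mathrm{inv}(D)$ is the minimum number of sets whose successive inversion yields an acyclic oriented graph. The dijoin $D_1\rightarrow D_2$ consists of vertex-disjoint copies of $D_1$, $D_2$ plus all edges $uv$ with $u\in V(D_1)$, $v\in V(D_2)$. -}

module Defs where

open import Data.Nat using (ℕ; _+_; _<_; _≤_)
open import Data.Fin using (Fin; splitAt)
open import Data.Bool using (Bool; true; false; _∧_; if_then_else_; T)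
open import Data.Sum using (_⊎_; inj₁; inj₂)
open import Data.Product using (_×_; Σ; ∃)
open import Data.List using (List; []; _∷_; length; foldl)
open import Data.Empty using (⊥)
open import Relation.Nullary using (¬_)
open import Relation.Binary.PropositionalEquality using (_≡_; _≢_)

record Digraph : Set where
  constructor digraph
  field
    size : ℕ
    adj  : Fin size → Fin size → Bool
open Digraph public

Edge : (D : Digraph) → Fin (size D) → Fin (size D) → Set
Edge D u v = T (adj D u v)

IsOriented : Digraph → Set
IsOriented D = (∀ u → ¬ Edge D u u) × (∀ u v → Edge D u v → ¬ Edge D v u)

IsTournament : Digraph → Set
IsTournament D = IsOriented D × (∀ u v → u ≢ v → Edge D u v ⊎ Edge D v u)

VSet : ℕ → Set
VSet n = Fin n → Bool

invert : (D : Digraph) → VSet (size D) → Digraph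
invert D X = digraph (size D)
  (λ u v → if X u ∧ X v then adj D v u else adj D u v)

invertAll : (D : Digraph) → List (VSet (size D)) → Digraph
invertAll (digraph n a) []       = digraph n a
invertAll (digraph n a) (X ∷ Xs) = invertAll (invert (digraph n a) X) Xs

data Walk (D : Digraph) : Fin (size D) → Fin (size D) → Set where
  step : ∀ {u v} → Edge D u v → Walk D u v
  _∷ʷ_ : ∀ {u v w} → Edge D u v → Walk D v w → Walk D u w

-- A directed cycle exists iff there is a closed directed walk of length ≥ 1.
HasDirectedCycle : Digraph → Set
HasDirectedCycle D = Σ (Fin (size D)) (λ v → Walk D v v)

IsAcyclic : Digraph → Set
IsAcyclic D = ¬ HasDirectedCycle D

InvertibleWith : Digraph → ℕ → Set
InvertibleWith D k =
  Σ (List (VSet (size D))) (λ Xs → (length Xs ≡ k) × IsAcyclic (invertAll D Xs))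

IsInv : Digraph → ℕ → Set
IsInv D k = InvertibleWith D k × (∀ m → m < k → ¬ InvertibleWith D m)

dijoin : Digraph → Digraph → Digraph
dijoin D₁ D₂ = digraph (size D₁ + size D₂) e
  where
  e : Fin (size D₁ + size D₂) → Fin (size D₁ + size D₂) → Bool
  e u v with splitAt (size D₁) u | splitAt (size D₁) v
  ... | inj₁ a | inj₁ b = adj D₁ a b
  ... | inj₂ a | inj₂ b = adj D₂ a b
  ... | inj₁ _ | inj₂ _ = true
  ... | inj₂ _ | inj₁ _ = false

{-# OPTIONS --safe #-}
-- A family of m sets is the labelling v ↦ (v ∈ X₁, …, v ∈ X_m) ∈ 𝔽₂^m, and inverting it
-- reverses exactly the arcs uv with ℓ u · ℓ v = 1; so D is invertible with m sets iff some
-- labelling of dimension m makes this reorientation of D acyclic. For a tournament acyclic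
-- means triangle-free, and inverting a convex set (one that no path leaves and re-enters)
-- keeps it so. Let ℓ be an acyclic labelling of D₁ → D₂ of dimension m ≥ 1. For w on one side,
-- the vertices a of the other side with ℓ a · ℓ w = 1 are those whose arc with w was reversed;
-- they form an up-set (or a down-set) of that side, so they and the symmetric difference of
-- two of them are convex. A case analysis on the labels finds a side and either a vector g
-- with g · g = 1 and a zero coordinate for which a ↦ ℓ a · g is such a convex set, or an
-- isotropic vector orthogonal to all labels of the side, or only labels 0 and 1 there.
-- Projecting along g, contracting along the isotropic vector, or collapsing {0, 1} onto a line
-- gives a labelling of that side of dimension m − 1 that acts as ℓ followed by the inversion
-- of a convex set, hence an acyclic one: inv(D₁) or inv(D₂) is at most m − 1 < k.

module Submission where

open import Defs
open import Data.Nat using (ℕ; _<_; _≤_)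
open import Relation.Nullary using (¬_)

open import Data.Nat using (zero; suc; _+_)
open import Data.Bool using (Bool; true; false; _∧_; _xor_; if_then_else_; T; b≤b; f≤t)
  renaming (_≤_ to _≤ᵇ_)
open import Data.Bool.Properties
  using ( ∧-comm; ∧-idem; ∧-identityʳ; xor-comm; xor-assoc; xor-identityʳ; xor-same; ¬-not
        ; ≤-reflexive; ≤-minimum; if-cong; if-cong₂; xor-∧-commutativeRing )
  renaming (_≟_ to _≟ᵇ_)
open import Data.Empty using (⊥; ⊥-elim)
open import Data.Fin using (Fin; zero; suc; _↑ˡ_; _↑ʳ_; _≟_)
open import Data.Fin.Properties using (any?; all?; ¬∀⟶∃¬; splitAt-↑ˡ; splitAt-↑ʳ)
open import Data.List using (List; []; _∷_; length)
open import Data.Maybe using (just; nothing)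
open import Level using (0ℓ)
open import Data.Product using (Σ-syntax; ∃-syntax; _×_; _,_)
open import Data.Sum as Sum using (_⊎_; inj₁; inj₂; [_,_]′; swap)
open import Data.Unit using (tt)
open import Data.Vec using (Vec; []; _∷_; head; tail; zipWith; map; replicate; lookup; removeAt)
open import Data.Vec.Properties using (lookup-zipWith; lookup-map; lookup-replicate)
  renaming (≡-dec to ≡-decᵛ)
open import Function using (_∘_; id; _⇔_; mk⇔; Equivalence)
open import Relation.Nullary using (Dec; yes; no)
open import Relation.Nullary.Decidable using (_×-dec_; _⊎-dec_)
open import Relation.Binary.PropositionalEquality
  using (_≡_; _≢_; refl; sym; trans; cong; cong₂; subst; subst₂; module ≡-Reasoning)
open import Tactic.RingSolver using (solve-∀)
open import Tactic.RingSolver.Core.AlmostCommutativeRing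
  using (AlmostCommutativeRing; fromCommutativeRing)

private
  variable
    m n : ℕ

-- Inner products over 𝔽₂

-- The solver normalises coefficients in Bool itself, so it also knows that 1 + 1 = 0.
Bool-ring : AlmostCommutativeRing 0ℓ 0ℓ
Bool-ring = fromCommutativeRing xor-∧-commutativeRing λ { false → just refl ; true → nothing }

infixl 6 _⊕_
infixr 8 _∙_
infix  7 _·_

_⊕_ : Vec Bool m → Vec Bool m → Vec Bool m
_⊕_ = zipWith _xor_

_∙_ : Bool → Vec Bool m → Vec Bool m
c ∙ x = map (c ∧_) x

ones zeros : Vec Bool m
ones  = replicate _ true
zeros = replicate _ false

_·_ : Vec Bool m → Vec Bool m → Bool
[]      · []      = false
(a ∷ x) · (b ∷ y) = a ∧ b xor x · y

·-comm : (x y : Vec Bool m) → x · y ≡ y · x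
·-comm []      []      = refl
·-comm (a ∷ x) (b ∷ y) = cong₂ _xor_ (∧-comm a b) (·-comm x y)

·-head-tail : (x y : Vec Bool (suc m)) → head x ∧ head y xor tail x · tail y ≡ x · y
·-head-tail (a ∷ x) (b ∷ y) = refl

·-distribˡ-⊕ : (x y z : Vec Bool m) → x · (y ⊕ z) ≡ x · y xor x · z
·-distribˡ-⊕ []      []      []      = refl
·-distribˡ-⊕ (a ∷ x) (b ∷ y) (c ∷ z) rewrite ·-distribˡ-⊕ x y z = expand a b c (x · y) (x · z)
  where
  expand : ∀ a b c s t → a ∧ (b xor c) xor (s xor t) ≡ (a ∧ b xor s) xor (a ∧ c xor t)
  expand = solve-∀ Bool-ring

·-distribʳ-⊕ : (x y z : Vec Bool m) → (x ⊕ y) · z ≡ x · z xor y · z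
·-distribʳ-⊕ x y z = begin
  (x ⊕ y) · z      ≡⟨ ·-comm (x ⊕ y) z ⟩
  z · (x ⊕ y)      ≡⟨ ·-distribˡ-⊕ z x y ⟩
  z · x xor z · y  ≡⟨ cong₂ _xor_ (·-comm z x) (·-comm z y) ⟩
  x · z xor y · z  ∎
  where open ≡-Reasoning

⊕-·-self : (x y : Vec Bool m) → (x ⊕ y) · (x ⊕ y) ≡ x · x xor y · y
⊕-·-self x y = begin
  (x ⊕ y) · (x ⊕ y)                      ≡⟨ ·-distribʳ-⊕ x y (x ⊕ y) ⟩
  x · (x ⊕ y) xor y · (x ⊕ y)            ≡⟨ cong₂ _xor_ (·-distribˡ-⊕ x x y) (·-distribˡ-⊕ y x y) ⟩
  (x · x xor x · y) xor (y · x xor y · y) ≡⟨ cong (λ t → (x · x xor x · y) xor (t xor y · y)) (·-comm y x) ⟩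
  (x · x xor x · y) xor (x · y xor y · y) ≡⟨ cancel (x · x) (x · y) (y · y) ⟩
  x · x xor y · y                        ∎
  where
  open ≡-Reasoning
  cancel : ∀ s t u → (s xor t) xor (t xor u) ≡ s xor u
  cancel = solve-∀ Bool-ring

·-zeroˡ : (x : Vec Bool m) → zeros · x ≡ false
·-zeroˡ []      = refl
·-zeroˡ (a ∷ x) = ·-zeroˡ x

·-self : (x : Vec Bool m) → x · x ≡ x · ones
·-self []      = refl
·-self (a ∷ x) = cong₂ _xor_ (trans (∧-idem a) (sym (∧-identityʳ a))) (·-self x)

·-shear : (x y g : Vec Bool m) (a b : Bool) →
  (x ⊕ a ∙ g) · (y ⊕ b ∙ g) ≡ x · y xor b ∧ x · g xor a ∧ g · y xor a ∧ b ∧ g · g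
·-shear []      []      []      a b = vanish a b
  where
  vanish : ∀ a b → false ≡ false xor b ∧ false xor a ∧ false xor a ∧ b ∧ false
  vanish = solve-∀ Bool-ring
·-shear (x₀ ∷ x) (y₀ ∷ y) (g₀ ∷ g) a b rewrite ·-shear x y g a b =
  expand x₀ y₀ g₀ a b (x · y) (x · g) (g · y) (g · g)
  where
  expand : ∀ x₀ y₀ g₀ a b xy xg gy gg →
    (x₀ xor a ∧ g₀) ∧ (y₀ xor b ∧ g₀) xor (xy xor b ∧ xg xor a ∧ gy xor a ∧ b ∧ gg)
      ≡ (x₀ ∧ y₀ xor xy) xor b ∧ (x₀ ∧ g₀ xor xg) xor a ∧ (g₀ ∧ y₀ xor gy) xor a ∧ b ∧ (g₀ ∧ g₀ xor gg)
  expand = solve-∀ Bool-ring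

·-removeAt : (x y : Vec Bool (suc m)) (p : Fin (suc m)) →
  x · y ≡ removeAt x p · removeAt y p xor lookup x p ∧ lookup y p
·-removeAt (a ∷ x)         (b ∷ y)         zero    = xor-comm (a ∧ b) (x · y)
·-removeAt (a ∷ x@(_ ∷ _)) (b ∷ y@(_ ∷ _)) (suc p) rewrite ·-removeAt x y p =
  sym (xor-assoc (a ∧ b) (removeAt x p · removeAt y p) (lookup x p ∧ lookup y p))

lookup-shear : (x g : Vec Bool m) (a : Bool) (p : Fin m) →
  lookup (x ⊕ a ∙ g) p ≡ lookup x p xor a ∧ lookup g p
lookup-shear x g a p =
  trans (lookup-zipWith _xor_ p x (a ∙ g)) (cong (lookup x p xor_) (lookup-map p (a ∧_) g))

·-removeAt-shear : (x y g : Vec Bool (suc m)) (a b : Bool) (p : Fin (suc m)) →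
  removeAt (x ⊕ a ∙ g) p · removeAt (y ⊕ b ∙ g) p
    ≡ (x · y xor b ∧ x · g xor a ∧ g · y xor a ∧ b ∧ g · g)
      xor (lookup x p xor a ∧ lookup g p) ∧ (lookup y p xor b ∧ lookup g p)
·-removeAt-shear {m} x y g a b p = begin
  removeAt x′ p · removeAt y′ p
    ≡⟨ cancel (removeAt x′ p · removeAt y′ p) (lookup x′ p ∧ lookup y′ p) ⟩
  (removeAt x′ p · removeAt y′ p xor lookup x′ p ∧ lookup y′ p) xor lookup x′ p ∧ lookup y′ p
    ≡⟨ cong₂ _xor_ (sym (·-removeAt x′ y′ p)) (cong₂ _∧_ (lookup-shear x g a p) (lookup-shear y g b p)) ⟩
  x′ · y′ xor (lookup x p xor a ∧ lookup g p) ∧ (lookup y p xor b ∧ lookup g p)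
    ≡⟨ cong (_xor (lookup x p xor a ∧ lookup g p) ∧ (lookup y p xor b ∧ lookup g p)) (·-shear x y g a b) ⟩
  (x · y xor b ∧ x · g xor a ∧ g · y xor a ∧ b ∧ g · g)
    xor (lookup x p xor a ∧ lookup g p) ∧ (lookup y p xor b ∧ lookup g p) ∎
  where
  open ≡-Reasoning
  x′ y′ : Vec Bool (suc m)
  x′ = x ⊕ a ∙ g
  y′ = y ⊕ b ∙ g
  cancel : ∀ s t → s ≡ (s xor t) xor t
  cancel = solve-∀ Bool-ring

_≟ᵛ_ : (x y : Vec Bool m) → Dec (x ≡ y)
_≟ᵛ_ = ≡-decᵛ _≟ᵇ_

ones-or-hole : (x : Vec Bool m) → x ≡ ones ⊎ ∃[ p ] lookup x p ≡ false
ones-or-hole []          = inj₁ refl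
ones-or-hole (false ∷ x) = inj₂ (zero , refl)
ones-or-hole (true ∷ x) with ones-or-hole x
... | inj₁ refl          = inj₁ refl
... | inj₂ (p , hole)    = inj₂ (suc p , hole)

zeros-or-support : (x : Vec Bool m) → x ≡ zeros ⊎ ∃[ p ] lookup x p ≡ true
zeros-or-support []          = inj₁ refl
zeros-or-support (true ∷ x)  = inj₂ (zero , refl)
zeros-or-support (false ∷ x) with zeros-or-support x
... | inj₁ refl              = inj₁ refl
... | inj₂ (p , support)     = inj₂ (suc p , support)

OddWithHole : Vec Bool m → Set
OddWithHole x = x · x ≡ true × ∃[ p ] lookup x p ≡ false

odd-with-hole? : (x : Vec Bool m) → Dec (OddWithHole x)
odd-with-hole? x = (x · x ≟ᵇ true) ×-dec any? (λ p → lookup x p ≟ᵇ false)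

OddIsOnes : Vec Bool m → Set
OddIsOnes x = x · x ≡ true → x ≡ ones

odd-without-hole : {x : Vec Bool m} → ¬ OddWithHole x → OddIsOnes x
odd-without-hole {x = x} no-hole odd with ones-or-hole x
... | inj₁ x≡ones = x≡ones
... | inj₂ hole   = ⊥-elim (no-hole (odd , hole))

Binary : Vec Bool m → Set
Binary x = x ≡ zeros ⊎ x ≡ ones

binary? : (x : Vec Bool m) → Dec (Binary x)
binary? x = (x ≟ᵛ zeros) ⊎-dec (x ≟ᵛ ones)

binary-or-mixed : (x : Fin n → Vec Bool m) → (∀ a → Binary (x a)) ⊎ ∃[ a ] ¬ Binary (x a)
binary-or-mixed x with all? (binary? ∘ x)
... | yes binary = inj₁ binary
... | no  mixed  = inj₂ (¬∀⟶∃¬ _ _ (binary? ∘ x) mixed)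

mixed-isotropic : {x : Vec Bool m} → OddIsOnes x → ¬ Binary x →
  x · x ≡ false × ∃[ p ] lookup x p ≡ true
mixed-isotropic {x = x} odd⇒ones mixed with zeros-or-support x
... | inj₁ x≡zeros = ⊥-elim (mixed (inj₁ x≡zeros))
... | inj₂ support = ¬-not (λ odd → mixed (inj₂ (odd⇒ones odd))) , support

even-weight : {x : Vec Bool m} → OddIsOnes x → ones {m} · ones ≡ false → x · ones ≡ false
even-weight {x = x} odd⇒ones ones-even with x · x in xx
... | false = trans (sym (·-self x)) xx
... | true  = subst (λ y → y · ones ≡ false) (sym (odd⇒ones refl)) ones-even

-- Maps to a lower dimension

-- The shear x ↦ x ⊕ (x · g ⊕ x_p) g fixes coordinate p (as g_p = 0) and, as g · g = 1, adds
-- (x · g)(y · g) + x_p y_p to the Gram matrix; dropping coordinate p removes the second term.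
project : Vec Bool (suc m) → Fin (suc m) → Vec Bool (suc m) → Vec Bool m
project g p x = removeAt (x ⊕ (x · g xor lookup x p) ∙ g) p

project-· : (g : Vec Bool (suc m)) (p : Fin (suc m)) → g · g ≡ true → lookup g p ≡ false →
  ∀ x y → project g p x · project g p y ≡ x · y xor x · g ∧ y · g
project-· g p gg gp x y =
  trans (·-removeAt-shear x y g (x · g xor lookup x p) (y · g xor lookup y p) p)
        (substituted (x · y) (x · g) (y · g) (lookup x p) (lookup y p) (·-comm g y) gg gp)
  where
  identity : ∀ xy xg yg xp yp →
    (xy xor (yg xor yp) ∧ xg xor (xg xor xp) ∧ yg xor (xg xor xp) ∧ (yg xor yp) ∧ true)
      xor (xp xor (xg xor xp) ∧ false) ∧ (yp xor (yg xor yp) ∧ false)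
    ≡ xy xor xg ∧ yg
  identity = solve-∀ Bool-ring
  substituted : ∀ xy xg yg xp yp {gy gg gp} → gy ≡ yg → gg ≡ true → gp ≡ false →
    (xy xor (yg xor yp) ∧ xg xor (xg xor xp) ∧ gy xor (xg xor xp) ∧ (yg xor yp) ∧ gg)
      xor (xp xor (xg xor xp) ∧ gp) ∧ (yp xor (yg xor yp) ∧ gp)
    ≡ xy xor xg ∧ yg
  substituted xy xg yg xp yp refl refl refl = identity xy xg yg xp yp

-- On vectors orthogonal to h, with h · h = 0 and h_p = 1, the shear x ↦ x ⊕ x_p h preserves
-- the inner product and clears coordinate p.
contract : Vec Bool (suc m) → Fin (suc m) → Vec Bool (suc m) → Vec Bool m
contract h p x = removeAt (x ⊕ lookup x p ∙ h) p

contract-· : (h : Vec Bool (suc m)) (p : Fin (suc m)) → h · h ≡ false → lookup h p ≡ true →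
  ∀ x y → x · h ≡ false → y · h ≡ false → contract h p x · contract h p y ≡ x · y
contract-· h p hh hp x y xh yh =
  trans (·-removeAt-shear x y h (lookup x p) (lookup y p) p)
        (substituted (x · y) (lookup x p) (lookup y p) xh (trans (·-comm h y) yh) hh hp)
  where
  identity : ∀ xy xp yp →
    (xy xor yp ∧ false xor xp ∧ false xor xp ∧ yp ∧ false) xor (xp xor xp ∧ true) ∧ (yp xor yp ∧ true)
    ≡ xy
  identity = solve-∀ Bool-ring
  substituted : ∀ xy xp yp {xh hy hh hp} → xh ≡ false → hy ≡ false → hh ≡ false → hp ≡ true →
    (xy xor yp ∧ xh xor xp ∧ hy xor xp ∧ yp ∧ hh) xor (xp xor xp ∧ hp) ∧ (yp xor yp ∧ hp)
    ≡ xy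
  substituted xy xp yp refl refl refl refl = identity xy xp yp

collapse : Vec Bool n → Vec Bool (suc m)
collapse x = x · ones ∷ zeros

collapse-· : (x y : Vec Bool n) → collapse {m = m} x · collapse y ≡ x · ones ∧ y · ones
collapse-· {m = m} x y = trans (cong (x · ones ∧ y · ones xor_) (·-zeroˡ (zeros {m}))) (xor-identityʳ _)

·-binary : ones {m} · ones ≡ true → {x y : Vec Bool m} → Binary x → Binary y → x · y ≡ x · ones ∧ y · ones
·-binary {m} _ {y = y} (inj₁ refl) _ rewrite ·-zeroˡ y | ·-zeroˡ (ones {m}) = refl
·-binary {m} ones-odd (inj₂ refl) (inj₁ refl)
  rewrite ·-comm (ones {m}) zeros | ·-zeroˡ (ones {m}) | ones-odd = refl
·-binary ones-odd (inj₂ refl) (inj₂ refl) rewrite ones-odd = refl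

·-dim-one : (x y g : Vec Bool 1) → g · g ≡ true → x · y ≡ x · g ∧ y · g
·-dim-one (a ∷ []) (b ∷ []) (true ∷ []) _ = identity a b
  where
  identity : ∀ a b → a ∧ b xor false ≡ (a ∧ true xor false) ∧ (b ∧ true xor false)
  identity = solve-∀ Bool-ring

·-dim-one-isotropic : (x y : Vec Bool 1) → x · x ≡ false → x · y ≡ false
·-dim-one-isotropic (false ∷ []) (b ∷ []) _ = refl

-- Reorienting tournaments

-- invert D X is definitionally reorient D (λ u v → X u ∧ X v).
reorient : (D : Digraph) → (Fin (size D) → Fin (size D) → Bool) → Digraph
reorient D P = digraph (size D) λ u v → if P u v then adj D v u else adj D u v

reorient-reorient : ∀ {D} {P Q : Fin (size D) → Fin (size D) → Bool} → (∀ u v → P v u ≡ P u v) →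
  ∀ u v → adj (reorient (reorient D P) Q) u v ≡ adj (reorient D (λ u v → P u v xor Q u v)) u v
reorient-reorient {P = P} {Q} P-sym u v rewrite P-sym u v with P u v | Q u v
... | false | false = refl
... | false | true  = refl
... | true  | false = refl
... | true  | true  = refl

walk-map : ∀ {D D′} (f : Fin (size D) → Fin (size D′)) → (∀ {a b} → Edge D a b → Edge D′ (f a) (f b)) →
  ∀ {u v} → Walk D u v → Walk D′ (f u) (f v)
walk-map f arc (step e)  = step (arc e)
walk-map f arc (e ∷ʷ w) = arc e ∷ʷ walk-map f arc w

acyclic-resp : {A B : Fin n → Fin n → Bool} → (∀ u v → A u v ≡ B u v) →
  IsAcyclic (digraph n A) → IsAcyclic (digraph n B)
acyclic-resp A≗B acyclic (v , cycle) =
  acyclic (v , walk-map id (λ {a} {b} → subst T (sym (A≗B a b))) cycle)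

TriangleFree : Digraph → Set
TriangleFree D = ∀ {a b c} → Edge D a b → Edge D b c → Edge D c a → ⊥

acyclic⇒triangleFree : ∀ {D} → IsAcyclic D → TriangleFree D
acyclic⇒triangleFree acyclic ab bc ca = acyclic (_ , ab ∷ʷ (bc ∷ʷ step ca))

no-back-arc : ∀ {D} → IsTournament D → TriangleFree D → ∀ {u v} → Walk D u v → Edge D v u → ⊥
no-back-arc ((_ , antisym) , _) _ (step uv) vu = antisym _ _ uv vu
no-back-arc t@((_ , antisym) , total) tf {v = v} (_∷ʷ_ {v = w} uw wv) vu with w ≟ v
... | yes refl = antisym _ _ uw vu
... | no w≢v with total v w (w≢v ∘ sym)
...   | inj₁ vw = no-back-arc t tf wv vw
...   | inj₂ wv′ = tf uw wv′ vu

triangleFree⇒acyclic : ∀ {D} → IsTournament D → TriangleFree D → IsAcyclic D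
triangleFree⇒acyclic ((loopless , _) , _) _  (v , step vv)    = loopless v vv
triangleFree⇒acyclic t                   tf (v , vw ∷ʷ wv) = no-back-arc t tf wv vw

reorient-tournament : ∀ {D} {P : Fin (size D) → Fin (size D) → Bool} →
  IsTournament D → (∀ u v → P v u ≡ P u v) → IsTournament (reorient D P)
reorient-tournament {D} {P} ((loopless , antisym) , total) P-sym = (loopless′ , antisym′) , total′
  where
  loopless′ : ∀ u → ¬ Edge (reorient D P) u u
  loopless′ u with P u u
  ... | true  = loopless u
  ... | false = loopless u
  antisym′ : ∀ u v → Edge (reorient D P) u v → ¬ Edge (reorient D P) v u
  antisym′ u v rewrite P-sym u v with P u v
  ... | true  = antisym v u
  ... | false = antisym u v
  total′ : ∀ u v → u ≢ v → Edge (reorient D P) u v ⊎ Edge (reorient D P) v u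
  total′ u v u≢v rewrite P-sym u v with P u v
  ... | true  = swap (total u v u≢v)
  ... | false = total u v u≢v

Convex : (D : Digraph) → (Fin (size D) → Bool) → Set
Convex D S = ∀ {a b c} → Edge D a b → Edge D b c → S a ∧ S c ≤ᵇ S b

private
  outside : ∀ {x y z} → x ≡ true → y ≡ true → z ≡ false → x ∧ y ≤ᵇ z → ⊥
  outside refl refl refl ()

-- A triangle with exactly two vertices in S has one reversed arc, so it comes from a path
-- that leaves S and re-enters it.
reorient-convex : ∀ {D S} → TriangleFree D → Convex D S → TriangleFree (reorient D (λ u v → S u ∧ S v))
reorient-convex {S = S} tf convex {a} {b} {c} ab bc ca with S a in sa | S b in sb | S c in sc
... | true  | true  | true  = tf ca bc ab
... | true  | true  | false = outside sb sa sc (convex bc ca)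
... | true  | false | true  = outside sa sc sb (convex ab bc)
... | false | true  | true  = outside sc sb sa (convex ca ab)
... | true  | false | false = tf ab bc ca
... | false | true  | false = tf ab bc ca
... | false | false | true  = tf ab bc ca
... | false | false | false = tf ab bc ca

convex-resp : ∀ {D S S′} → (∀ a → S a ≡ S′ a) → Convex D S → Convex D S′
convex-resp {S = S} {S′} S≗S′ convex {a} {b} {c} ab bc =
  subst₂ _≤ᵇ_ (cong₂ _∧_ (S≗S′ a) (S≗S′ c)) (S≗S′ b) (convex ab bc)

UpSet DownSet : (D : Digraph) → (Fin (size D) → Bool) → Set
UpSet   D S = ∀ a b → Edge D a b → S a ≤ᵇ S b
DownSet D S = ∀ a b → Edge D a b → S b ≤ᵇ S a

xor-between : ∀ {a b c a′ b′ c′} → a ≤ᵇ b → b ≤ᵇ c → a′ ≤ᵇ b′ → b′ ≤ᵇ c′ →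
  (a xor a′) ∧ (c xor c′) ≤ᵇ b xor b′
xor-between {a} {a′ = a′} b≤b b≤b b≤b b≤b = ≤-reflexive (∧-idem (a xor a′))
xor-between {true}      b≤b b≤b f≤t b≤b = ≤-minimum _
xor-between {false}     b≤b b≤b f≤t b≤b = ≤-minimum _
xor-between {true}      b≤b b≤b b≤b f≤t = ≤-minimum _
xor-between {false}     b≤b b≤b b≤b f≤t = ≤-minimum _
xor-between {a′ = true}  f≤t b≤b b≤b b≤b = ≤-minimum _
xor-between {a′ = false} f≤t b≤b b≤b b≤b = ≤-minimum _
xor-between {a′ = true}  b≤b f≤t b≤b b≤b = ≤-minimum _
xor-between {a′ = false} b≤b f≤t b≤b b≤b = ≤-minimum _
xor-between f≤t b≤b f≤t b≤b = ≤-minimum _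
xor-between f≤t b≤b b≤b f≤t = ≤-minimum _
xor-between b≤b f≤t f≤t b≤b = ≤-minimum _
xor-between b≤b f≤t b≤b f≤t = ≤-minimum _

xor-upSets-convex : ∀ {D S S′} → UpSet D S → UpSet D S′ → Convex D (λ a → S a xor S′ a)
xor-upSets-convex up up′ ab bc = xor-between (up _ _ ab) (up _ _ bc) (up′ _ _ ab) (up′ _ _ bc)

xor-downSets-convex : ∀ {D S S′} → DownSet D S → DownSet D S′ → Convex D (λ a → S a xor S′ a)
xor-downSets-convex {S = S} {S′} down down′ {a} {b} {c} ab bc =
  subst (_≤ᵇ S b xor S′ b) (∧-comm (S c xor S′ c) (S a xor S′ a))
    (xor-between (down _ _ bc) (down _ _ ab) (down′ _ _ bc) (down′ _ _ ab))

upSet-convex : ∀ {D S} → UpSet D S → Convex D S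
upSet-convex {D} {S} up =
  convex-resp (λ a → xor-identityʳ (S a)) (xor-upSets-convex {D} {S} up (λ _ _ _ → b≤b))

downSet-convex : ∀ {D S} → DownSet D S → Convex D S
downSet-convex {D} {S} down =
  convex-resp (λ a → xor-identityʳ (S a)) (xor-downSets-convex {D} {S} down (λ _ _ _ → b≤b))

-- Inversion families as labellings

Labelling : ℕ → ℕ → Set
Labelling n m = Fin n → Vec Bool m

gram : Labelling n m → Fin n → Fin n → Bool
gram ℓ u v = ℓ u · ℓ v

gram-sym : (ℓ : Labelling n m) → ∀ u v → gram ℓ v u ≡ gram ℓ u v
gram-sym ℓ u v = ·-comm (ℓ v) (ℓ u)

labelling : (Xs : List (VSet n)) → Labelling n (length Xs)
labelling []       v = []
labelling (X ∷ Xs) v = X v ∷ labelling Xs v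

invertAll-acyclic⇔ : ∀ D Xs → IsAcyclic (invertAll D Xs) ⇔ IsAcyclic (reorient D (gram (labelling Xs)))
invertAll-acyclic⇔ D []       = mk⇔ id id
invertAll-acyclic⇔ D (X ∷ Xs) =
  mk⇔ (acyclic-resp merge ∘ to) (from ∘ acyclic-resp (λ u v → sym (merge u v)))
  where
  open Equivalence (invertAll-acyclic⇔ (invert D X) Xs)
  merge : ∀ u v → adj (reorient (invert D X) (gram (labelling Xs))) u v
                 ≡ adj (reorient D (gram (labelling (X ∷ Xs)))) u v
  merge = reorient-reorient {D} {λ u v → X u ∧ X v} {gram (labelling Xs)} (λ u v → ∧-comm (X v) (X u))

family : Labelling n m → List (VSet n)
family {m = zero}  ℓ = []
family {m = suc m} ℓ = head ∘ ℓ ∷ family (tail ∘ ℓ)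

length-family : (ℓ : Labelling n m) → length (family ℓ) ≡ m
length-family {m = zero}  ℓ = refl
length-family {m = suc m} ℓ = cong suc (length-family (tail ∘ ℓ))

gram-labelling-family : (ℓ : Labelling n m) → ∀ u v → gram (labelling (family ℓ)) u v ≡ gram ℓ u v
gram-labelling-family {m = zero}  ℓ u v with ℓ u | ℓ v
... | [] | [] = refl
gram-labelling-family {m = suc m} ℓ u v =
  trans (cong (head (ℓ u) ∧ head (ℓ v) xor_) (gram-labelling-family (tail ∘ ℓ) u v))
        (·-head-tail (ℓ u) (ℓ v))

invertible⇒labelling : ∀ {D} → InvertibleWith D m →
  Σ[ ℓ ∈ Labelling (size D) m ] IsAcyclic (reorient D (gram ℓ))
invertible⇒labelling {D = D} (Xs , refl , acyclic) =
  labelling Xs , Equivalence.to (invertAll-acyclic⇔ D Xs) acyclic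

labelling⇒invertible : ∀ {D} (ℓ : Labelling (size D) m) → IsAcyclic (reorient D (gram ℓ)) →
  InvertibleWith D m
labelling⇒invertible {D = D} ℓ acyclic =
  family ℓ , length-family ℓ ,
  Equivalence.from (invertAll-acyclic⇔ D (family ℓ))
    (acyclic-resp (λ u v → if-cong (sym (gram-labelling-family ℓ u v))) acyclic)

record Replacement (D : Digraph) (ℓ : Labelling (size D) m) (m′ : ℕ) : Set where
  field
    labels      : Labelling (size D) m′
    flip        : Fin (size D) → Bool
    flip-convex : Convex (reorient D (gram ℓ)) flip
    gram-labels : ∀ a b → gram labels a b ≡ gram ℓ a b xor flip a ∧ flip b

replacement-invertible : ∀ {D} {ℓ : Labelling (size D) m} {m′} → IsTournament D →
  TriangleFree (reorient D (gram ℓ)) → Replacement D ℓ m′ → InvertibleWith D m′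
replacement-invertible {D = D} {ℓ} tournament triangleFree r =
  labelling⇒invertible labels (acyclic-resp same flipped-acyclic)
  where
  open Replacement r
  flipped : Digraph
  flipped = reorient (reorient D (gram ℓ)) (λ u v → flip u ∧ flip v)
  flipped-acyclic : IsAcyclic flipped
  flipped-acyclic = triangleFree⇒acyclic
    (reorient-tournament (reorient-tournament tournament (gram-sym ℓ)) (λ u v → ∧-comm (flip v) (flip u)))
    (reorient-convex {reorient D (gram ℓ)} {flip} triangleFree flip-convex)
  same : ∀ u v → adj flipped u v ≡ adj (reorient D (gram labels)) u v
  same u v = trans (reorient-reorient {D} {gram ℓ} {λ u v → flip u ∧ flip v} (gram-sym ℓ) u v)
                   (if-cong (sym (gram-labels u v)))

module _ {D : Digraph} {m : ℕ} {ℓ : Labelling (size D) (suc m)} where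

  by-projection : ∀ g p → g · g ≡ true → lookup g p ≡ false →
    Convex (reorient D (gram ℓ)) (λ a → ℓ a · g) → Replacement D ℓ m
  by-projection g p gg gp convex = record
    { labels      = project g p ∘ ℓ
    ; flip        = λ a → ℓ a · g
    ; flip-convex = convex
    ; gram-labels = λ a b → project-· g p gg gp (ℓ a) (ℓ b)
    }

  by-contraction : ∀ h p → h · h ≡ false → lookup h p ≡ true → (∀ a → ℓ a · h ≡ false) → Replacement D ℓ m
  by-contraction h p hh hp ⊥h = record
    { labels      = contract h p ∘ ℓ
    ; flip        = λ _ → false
    ; flip-convex = λ _ _ → b≤b
    ; gram-labels = λ a b →
      trans (contract-· h p hh hp (ℓ a) (ℓ b) (⊥h a) (⊥h b)) (sym (xor-identityʳ _))
    }

by-collapse : ∀ {D m m′} {ℓ : Labelling (size D) m} → ones {m} · ones ≡ true → (∀ a → Binary (ℓ a)) →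
  Replacement D ℓ (suc m′)
by-collapse {m′ = m′} {ℓ = ℓ} ones-odd binary = record
  { labels      = collapse ∘ ℓ
  ; flip        = λ _ → false
  ; flip-convex = λ _ _ → b≤b
  ; gram-labels = λ a b → trans (collapse-· {m = m′} (ℓ a) (ℓ b))
      (sym (trans (xor-identityʳ _) (·-binary ones-odd (binary a) (binary b))))
  }

by-rank-one : ∀ {D m m′} {ℓ : Labelling (size D) m} {S} → Convex (reorient D (gram ℓ)) S →
  (∀ a b → gram ℓ a b ≡ S a ∧ S b) → Replacement D ℓ m′
by-rank-one {m′ = m′} {S = S} convex rank-one = record
  { labels      = λ _ → zeros
  ; flip        = S
  ; flip-convex = convex
  ; gram-labels = λ a b → trans (·-zeroˡ (zeros {m′}))
      (sym (trans (cong (_xor S a ∧ S b) (rank-one a b)) (xor-same (S a ∧ S b))))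
  }

-- The dijoin

-- ℓ labels one side of a dijoin and ℓ° the other; λ a → ℓ a · ℓ° w is then the set of
-- vertices a whose arc with w is reversed.
module Side {m k : ℕ} {D : Digraph} (ℓ : Labelling (size D) (suc m)) (ℓ° : Labelling k (suc m))
  (convex   : ∀ w → Convex (reorient D (gram ℓ)) (λ a → ℓ a · ℓ° w))
  (convex-⊕ : ∀ w w′ → Convex (reorient D (gram ℓ)) (λ a → ℓ a · ℓ° w xor ℓ a · ℓ° w′))
  where

  via-odd : ∀ w p → ℓ° w · ℓ° w ≡ true → lookup (ℓ° w) p ≡ false → Replacement D ℓ m
  via-odd w p odd hole = by-projection (ℓ° w) p odd hole (convex w)

  ParityTest : Set
  ParityTest = (∃[ w ] ℓ° w ≡ ones) ⊎ (∀ a → ℓ a · ones ≡ false)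

  -- g = ones ⊕ ℓ° w₀ is odd and vanishes where ℓ° w₀ is supported; a ↦ ℓ a · g differs from
  -- a ↦ ℓ a · ℓ° w₀ by the parity a ↦ ℓ a · ones, which the ParityTest makes harmless.
  via-mixed : ones {suc m} · ones ≡ true → ParityTest → (∀ w → OddIsOnes (ℓ° w)) →
    ∃[ w₀ ] ¬ Binary (ℓ° w₀) → Replacement D ℓ m
  via-mixed ones-odd test odd° (w₀ , mixed) with mixed-isotropic (odd° w₀) mixed
  ... | iso , p , support = by-projection g p gg gp (convex-g test)
    where
    g : Vec Bool (suc m)
    g = ones ⊕ ℓ° w₀
    gg : g · g ≡ true
    gg = trans (⊕-·-self ones (ℓ° w₀)) (cong₂ _xor_ ones-odd iso)
    gp : lookup g p ≡ false
    gp = trans (lookup-zipWith _xor_ p ones (ℓ° w₀)) (cong₂ _xor_ (lookup-replicate p true) support)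
    split : ∀ a → ℓ a · g ≡ ℓ a · ones xor ℓ a · ℓ° w₀
    split a = ·-distribˡ-⊕ (ℓ a) ones (ℓ° w₀)
    convex-g : ParityTest → Convex (reorient D (gram ℓ)) (λ a → ℓ a · g)
    convex-g (inj₁ (w , ℓ°w≡ones)) =
      convex-resp (λ a → sym (trans (split a) (cong (λ v → ℓ a · v xor ℓ a · ℓ° w₀) (sym ℓ°w≡ones))))
        (convex-⊕ w w₀)
    convex-g (inj₂ even) =
      convex-resp (λ a → sym (trans (split a) (cong (_xor ℓ a · ℓ° w₀) (even a)))) (convex w₀)

module Dijoin (D₁ D₂ : Digraph) where

  L : Fin (size D₁) → Fin (size D₁ + size D₂)
  L a = a ↑ˡ size D₂

  R : Fin (size D₂) → Fin (size D₁ + size D₂)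
  R b = size D₁ ↑ʳ b

  private
    adj-LL : ∀ a b → adj (dijoin D₁ D₂) (L a) (L b) ≡ adj D₁ a b
    adj-LL a b rewrite splitAt-↑ˡ (size D₁) a (size D₂) | splitAt-↑ˡ (size D₁) b (size D₂) = refl

    adj-RR : ∀ a b → adj (dijoin D₁ D₂) (R a) (R b) ≡ adj D₂ a b
    adj-RR a b rewrite splitAt-↑ʳ (size D₁) (size D₂) a | splitAt-↑ʳ (size D₁) (size D₂) b = refl

    adj-LR : ∀ a b → adj (dijoin D₁ D₂) (L a) (R b) ≡ true
    adj-LR a b rewrite splitAt-↑ˡ (size D₁) a (size D₂) | splitAt-↑ʳ (size D₁) (size D₂) b = refl

  module Labelled {m} (ℓ : Labelling (size D₁ + size D₂) m) where

    T₁₂ : Digraph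
    T₁₂ = reorient (dijoin D₁ D₂) (gram ℓ)

    T₁ : Digraph
    T₁ = reorient D₁ (gram (ℓ ∘ L))

    T₂ : Digraph
    T₂ = reorient D₂ (gram (ℓ ∘ R))

    arc-LL : ∀ {a b} → Edge T₁ a b → Edge T₁₂ (L a) (L b)
    arc-LL {a} {b} = subst T (sym (if-cong₂ (gram ℓ (L a) (L b)) (adj-LL b a) (adj-LL a b)))

    arc-RR : ∀ {a b} → Edge T₂ a b → Edge T₁₂ (R a) (R b)
    arc-RR {a} {b} = subst T (sym (if-cong₂ (gram ℓ (R a) (R b)) (adj-RR b a) (adj-RR a b)))

    arc-RL : ∀ {a w} → ℓ (L a) · ℓ (R w) ≡ true → Edge T₁₂ (R w) (L a)
    arc-RL {a} {w} e rewrite ·-comm (ℓ (R w)) (ℓ (L a)) | e | adj-LR a w = tt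

    arc-LR : ∀ {a w} → ℓ (L a) · ℓ (R w) ≡ false → Edge T₁₂ (L a) (R w)
    arc-LR {a} {w} e rewrite e | adj-LR a w = tt

    restrictˡ : IsAcyclic T₁₂ → IsAcyclic T₁
    restrictˡ acyclic (v , cycle) = acyclic (L v , walk-map L arc-LL cycle)

    module _ (triangleFree : TriangleFree T₁₂) where

      triangleFree₁ : TriangleFree T₁
      triangleFree₁ ab bc ca = triangleFree (arc-LL ab) (arc-LL bc) (arc-LL ca)

      triangleFree₂ : TriangleFree T₂
      triangleFree₂ ab bc ca = triangleFree (arc-RR ab) (arc-RR bc) (arc-RR ca)

      upSet₁ : ∀ w → UpSet T₁ (λ a → ℓ (L a) · ℓ (R w))
      upSet₁ w a b ab with ℓ (L a) · ℓ (R w) in sa | ℓ (L b) · ℓ (R w) in sb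
      ... | false | _     = ≤-minimum _
      ... | true  | true  = b≤b
      ... | true  | false = ⊥-elim (triangleFree (arc-RL sa) (arc-LL ab) (arc-LR sb))

      downSet₂ : ∀ u → DownSet T₂ (λ b → ℓ (R b) · ℓ (L u))
      downSet₂ u a b ab with ℓ (R b) · ℓ (L u) in sb | ℓ (R a) · ℓ (L u) in sa
      ... | false | _     = ≤-minimum _
      ... | true  | true  = b≤b
      ... | true  | false =
        ⊥-elim (triangleFree (arc-LR (trans (·-comm (ℓ (L u)) (ℓ (R a))) sa)) (arc-RR ab)
                                (arc-RL (trans (·-comm (ℓ (L u)) (ℓ (R b))) sb)))

  module Sides {m} (ℓ : Labelling (size D₁ + size D₂) (suc m))
    (triangleFree : TriangleFree (Labelled.T₁₂ ℓ)) where
    open Labelled ℓ public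

    convex₁ : ∀ w → Convex T₁ (λ a → ℓ (L a) · ℓ (R w))
    convex₁ w = upSet-convex (upSet₁ triangleFree w)

    convex₂ : ∀ u → Convex T₂ (λ b → ℓ (R b) · ℓ (L u))
    convex₂ u = downSet-convex (downSet₂ triangleFree u)

    module Side₁ = Side (ℓ ∘ L) (ℓ ∘ R) convex₁
      (λ w w′ → xor-upSets-convex (upSet₁ triangleFree w) (upSet₁ triangleFree w′))
    module Side₂ = Side (ℓ ∘ R) (ℓ ∘ L) convex₂
      (λ u u′ → xor-downSets-convex (downSet₂ triangleFree u) (downSet₂ triangleFree u′))

  Outcome : ∀ {m} → Labelling (size D₁ + size D₂) (suc m) → Set
  Outcome {m} ℓ = Replacement D₁ (ℓ ∘ L) m ⊎ Replacement D₂ (ℓ ∘ R) m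

  dimension-one : (ℓ : Labelling (size D₁ + size D₂) 1) → TriangleFree (Labelled.T₁₂ ℓ) → Outcome ℓ
  dimension-one ℓ triangleFree with any? (λ w → ℓ (R w) · ℓ (R w) ≟ᵇ true)
  ... | yes (w , odd) = inj₁ (by-rank-one (convex₁ w) (λ a b → ·-dim-one (ℓ (L a)) (ℓ (L b)) (ℓ (R w)) odd))
    where open Sides ℓ triangleFree
  ... | no  no-odd    = inj₂ (by-rank-one {S = λ _ → false} (λ _ _ → b≤b)
      (λ a b → ·-dim-one-isotropic (ℓ (R a)) (ℓ (R b)) (¬-not (λ odd → no-odd (a , odd)))))

  module HigherDimension {m} (ℓ : Labelling (size D₁ + size D₂) (suc (suc m)))
    (triangleFree : TriangleFree (Labelled.T₁₂ ℓ)) where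
    open Sides ℓ triangleFree

    parity-test : (∀ u → OddIsOnes (ℓ (L u))) → Side₁.ParityTest ⊎ Side₂.ParityTest
    parity-test odd₁ with any? (λ w → ℓ (R w) ≟ᵛ ones) | any? (λ u → ℓ (L u) ≟ᵛ ones)
    ... | yes found₂ | _          = inj₁ (inj₁ found₂)
    ... | no _       | yes found₁ = inj₂ (inj₁ found₁)
    ... | no _       | no none₁   =
      inj₁ (inj₂ λ a → trans (sym (·-self (ℓ (L a)))) (¬-not (λ odd → none₁ (a , odd₁ a odd))))

    odd-dimension : ones {suc (suc m)} · ones ≡ true → (∀ u → OddIsOnes (ℓ (L u))) →
      (∀ w → OddIsOnes (ℓ (R w))) → Outcome ℓ
    odd-dimension ones-odd odd₁ odd₂ with parity-test odd₁
    ... | inj₁ test₁ =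
      [ inj₂ ∘ by-collapse ones-odd , inj₁ ∘ Side₁.via-mixed ones-odd test₁ odd₂ ]′ (binary-or-mixed (ℓ ∘ R))
    ... | inj₂ test₂ =
      [ inj₁ ∘ by-collapse ones-odd , inj₂ ∘ Side₂.via-mixed ones-odd test₂ odd₁ ]′ (binary-or-mixed (ℓ ∘ L))

    without-odd-holes : (∀ u → OddIsOnes (ℓ (L u))) →
      (∀ w → OddIsOnes (ℓ (R w))) → Outcome ℓ
    without-odd-holes odd₁ odd₂ with ones {suc (suc m)} · ones in ones-parity
    ... | false = inj₁ (by-contraction ones zero ones-parity refl (λ a → even-weight (odd₁ a) ones-parity))
    ... | true  = odd-dimension ones-parity odd₁ odd₂

    higher-dimension : Outcome ℓ
    higher-dimension with any? (odd-with-hole? ∘ ℓ ∘ R) | any? (odd-with-hole? ∘ ℓ ∘ L)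
    ... | yes (w , odd , p , hole) | _                        = inj₁ (Side₁.via-odd w p odd hole)
    ... | no _                     | yes (u , odd , p , hole) = inj₂ (Side₂.via-odd u p odd hole)
    ... | no none₂                 | no none₁                 = without-odd-holes
      (λ u → odd-without-hole (λ oh → none₁ (u , oh))) (λ w → odd-without-hole (λ oh → none₂ (w , oh)))

  dijoin-replacement : ∀ {m} (ℓ : Labelling (size D₁ + size D₂) (suc m)) →
    TriangleFree (Labelled.T₁₂ ℓ) → Outcome ℓ
  dijoin-replacement {zero}  = dimension-one
  dijoin-replacement {suc m} = HigherDimension.higher-dimension

dijoin-invertibleˡ : ∀ {D₁ D₂ m} → InvertibleWith (dijoin D₁ D₂) m → InvertibleWith D₁ m
dijoin-invertibleˡ {D₁} {D₂} inv with invertible⇒labelling inv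
... | ℓ , acyclic = labelling⇒invertible (ℓ ∘ L) (Labelled.restrictˡ ℓ acyclic)
  where open Dijoin D₁ D₂

dijoin-invertible : ∀ {D₁ D₂ m} → IsTournament D₁ → IsTournament D₂ →
  InvertibleWith (dijoin D₁ D₂) (suc m) → InvertibleWith D₁ m ⊎ InvertibleWith D₂ m
dijoin-invertible {D₁} {D₂} t₁ t₂ inv with invertible⇒labelling inv
... | ℓ , acyclic =
  Sum.map (replacement-invertible t₁ (triangleFree₁ tf)) (replacement-invertible t₂ (triangleFree₂ tf))
    (dijoin-replacement ℓ tf)
  where
  open Dijoin D₁ D₂
  open Labelled ℓ
  tf = acyclic⇒triangleFree acyclic

lemma4p1 : (D₁ D₂ : Digraph) → IsTournament D₁ → IsTournament D₂ →
    (k : ℕ) → 1 ≤ k → IsInv D₁ k → IsInv D₂ k →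
    ∀ m → m ≤ k → ¬ InvertibleWith (dijoin D₁ D₂) m
lemma4p1 D₁ D₂ _  _  k 1≤k (_ , minimal₁) _               zero    _   inv =
  minimal₁ 0 1≤k (dijoin-invertibleˡ inv)
lemma4p1 D₁ D₂ t₁ t₂ k _   (_ , minimal₁) (_ , minimal₂) (suc m) m<k inv =
  [ minimal₁ m m<k , minimal₂ m m<k ]′ (dijoin-invertible t₁ t₂ inv)
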